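{- Let $G$ be a finite connected graph in which every half-edge is labeled with exactly one label from $\{\mathsf{L},\mathsf{R},\mathsf{P},\mathsf{Ch_L},\mathsf{Ch_R}\}$ such that the following constraints hold at every node $u$: (a) any two edges $e,e'$ incident to $u$ have $L_u(e)\neq L_u(e')$; (b) for each edge $e=\{u,v\}$, if $L_u(e)=\mathsf{L}$ then $L_v(e)=\mathsf{R}$, and vice versa; (c) for each edge $e=\{u,v\}$, if $L_u(e)=\mathsf{P}$ then $L_v(e)\in\{\mathsf{Ch_L},\mathsf{Ch_R}\}$, and vice versa; (d) if $u$ has an incident edge $e=\{u,v\}$ with $L_u(e)=\mathsf{P}$ and $L_v(e)=\mathsf{Ch_L}$, then $f_u(\mathsf{P},\mathsf{Ch_R},\mathsf{L})=u$; (e) if $u$ has an incident edge $e=\{u,v\}$ with $L_u(e)=\mathsf{P}$ and $L_v(e)=\mathsf{Ch_R}$, and $u$ has an incident edge labeled $\mathsf{R}$, then $f_u(\mathsf{P},\mathsf{R},\mathsf{Ch_L},\mathsf{L})=u$; (f) if $u$ has an incident half-edge labeled $\mathsf{Ch_L}$ then it also has one labeled $\mathsf{Ch_R}$, and vice versa; (g) $u$ has no incident half-edge labeled $\mathsf{P}$ iff it has no incident half-edges labeled $\mathsf{L}$ or $\mathsf{R}$; (h) if $u$ has no incident edge $e$ with $L_u(e)\in\{\mathsf{Ch_L},\mathsf{Ch_R}\}$, then neither do the nodes $f_u(\mathsf{L})$ and $f_u(\mathsf{R})$ (if they exist); (i) if $u$ has an incident edge $e=\{u,v\}$ with $L_u(e)=\mathsf{P}$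 and $L_v(e)=\mathsf{Ch_R}$ (resp. $L_v(e)=\mathsf{Ch_L}$), then $u$ has an incident edge labeled $\mathsf{R}$ (resp. $\mathsf{L}$) iff $f_u(\mathsf{P})$ has an incident edge labeled $\mathsf{R}$ (resp. $\mathsf{L}$). Then $G$ is a tree-like structure.
   Context: $L_u(e)$ denotes the label of the half-edge $(u,e)$. For a node $u$ and labels $L_1,\dots,L_k$, $f_u(L_1,\dots,L_k)$ is defined as follows: consider the walk $u=v_1,v_2,\dots,v_{k+1}$ where for each $i$, $v_{i+1}$ is reached from $v_i$ via an edge $e_i=\{v_i,v_{i+1}\}$ with $L_{v_i}(e_i)=L_i$; if this walk exists and is unique, $f_u(L_1,\dots,L_k)=v_{k+1}$, otherwise $f_u(L_1,\dots,L_k)=\bot$ ("exists" means $\neq\bot$). A graph $G$ is a tree-like structure of height $\ell$ if its nodes can be assigned coordinates $(l_u,k_u)$ bijectively onto $\{(l,k): 0\le l<\ell,\ 0\le k<2^{l}\}$ such that for nodes $u,v$ with $l_v\le l_u$ and $k_v\le k_u$, there is an edge $\{u,v\}$ iff $(l_v,k_v)=(l_u-1,\lfloor k_u/2\rfloor)$ or $(l_u,k_u)=(l_v,k_v+1)$ (i.e., a complete binary tree in which additionally consecutive nodes of each level are joined by a path). -}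

module Defs where

open import Data.Nat using (ℕ; zero; suc; _<_; _^_; _/_)
open import Data.Fin using (Fin)
open import Data.Bool using (Bool; true; false)
open import Data.List using (List; []; _∷_)
open import Data.Product using (Σ; ∃; _×_; _,_; proj₁; proj₂)
open import Data.Sum using (_⊎_)
open import Relation.Nullary using (¬_)
open import Relation.Binary.PropositionalEquality using (_≡_; _≢_)
open import Function.Bundles using (_⇔_)

data Label : Set where
  L R P ChL ChR : Label

-- A finite simple graph on the vertex set Fin n, whose half-edges are labelled.
-- adj u v = true means {u,v} is an edge; lab u v is the label L_u({u,v}) of the
-- half-edge (u,{u,v}) (its value for non-adjacent pairs is irrelevant).
record LGraph (n : ℕ) : Set where
  field
    adj     : Fin n → Fin n → Bool
    adj-sym : ∀ u v → adj u v ≡ true → adj v u ≡ true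
    adj-irr : ∀ u → adj u u ≡ false
    lab     : Fin n → Fin n → Label

module _ {n : ℕ} (G : LGraph n) where
  open LGraph G

  data Reach : Fin n → Fin n → Set where
    here : ∀ {u} → Reach u u
    step : ∀ {u w v} → adj u w ≡ true → Reach w v → Reach u v

  Connected : Set
  Connected = ∀ u v → Reach u v

  data Walk : Fin n → List Label → Fin n → Set where
    []  : ∀ {u} → Walk u [] u
    _∷_ : ∀ {u w v l ls} → (adj u w ≡ true × lab u w ≡ l) → Walk w ls v → Walk u (l ∷ ls) v

  -- f u ls = v  (the walk exists and is unique, and ends at v)
  F : Fin n → List Label → Fin n → Set
  F u ls v = Σ (Walk u ls v) λ w →
               ∀ v′ (w′ : Walk u ls v′) → _≡_ {A = Σ (Fin n) (Walk u ls)} (v′ , w′) (v , w)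

  Has : Fin n → Label → Set
  Has u l = ∃ λ v → adj u v ≡ true × lab u v ≡ l

  NoCh : Fin n → Set
  NoCh u = ¬ Has u ChL × ¬ Has u ChR

  record Valid : Set where
    field
      ca : ∀ u v w → adj u v ≡ true → adj u w ≡ true → v ≢ w → lab u v ≢ lab u w
      cbL : ∀ u v → adj u v ≡ true → lab u v ≡ L → lab v u ≡ R
      cbR : ∀ u v → adj u v ≡ true → lab u v ≡ R → lab v u ≡ L
      ccP : ∀ u v → adj u v ≡ true → lab u v ≡ P → (lab v u ≡ ChL ⊎ lab v u ≡ ChR)
      cc-ChL : ∀ u v → adj u v ≡ true → lab u v ≡ ChL → lab v u ≡ P
      cc-ChR : ∀ u v → adj u v ≡ true → lab u v ≡ ChR → lab v u ≡ P
      cd : ∀ u v → adj u v ≡ true → lab u v ≡ P → lab v u ≡ ChL →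
             F u (P ∷ ChR ∷ L ∷ []) u
      ce : ∀ u v → adj u v ≡ true → lab u v ≡ P → lab v u ≡ ChR → Has u R →
             F u (P ∷ R ∷ ChL ∷ L ∷ []) u
      cf : ∀ u → Has u ChL ⇔ Has u ChR
      cg : ∀ u → (¬ Has u P) ⇔ (¬ Has u L × ¬ Has u R)
      chL : ∀ u → NoCh u → ∀ v → F u (L ∷ []) v → NoCh v
      chR : ∀ u → NoCh u → ∀ v → F u (R ∷ []) v → NoCh v
      ciR : ∀ u v → adj u v ≡ true → lab u v ≡ P → lab v u ≡ ChR →
              ∃ λ w → F u (P ∷ []) w × (Has u R ⇔ Has w R)
      ciL : ∀ u v → adj u v ≡ true → lab u v ≡ P → lab v u ≡ ChL →
              ∃ λ w → F u (P ∷ []) w × (Has u L ⇔ Has w L)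

TEdge : ℕ × ℕ → ℕ × ℕ → Set
TEdge (lu , ku) (lv , kv) = (lu ≡ suc lv × kv ≡ ku / 2) ⊎ (lu ≡ lv × ku ≡ suc kv)

TreeLike : ∀ {n} → LGraph n → ℕ → Set
TreeLike {n} G ℓ = Σ (Fin n → ℕ × ℕ) λ c →
    (∀ u → proj₁ (c u) < ℓ × proj₂ (c u) < 2 ^ proj₁ (c u))
  × (∀ u v → c u ≡ c v → u ≡ v)
  × (∀ l k → l < ℓ → k < 2 ^ l → ∃ λ u → c u ≡ (l , k))
  × (∀ u v → (LGraph.adj G u v ≡ true) ⇔ (TEdge (c u) (c v) ⊎ TEdge (c v) (c u)))

IsTreeLike : ∀ {n} → LGraph n → Set
IsTreeLike G = ∃ λ ℓ → TreeLike G ℓ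

module Submission where

-- A node without a P-labelled half-edge exists. Otherwise, following L- and R-edges yields
-- either an R-row from a node without L to a node without R, or a cycle of R-edges. By (d)
-- and (e) the parents of the nodes at even positions of such a row form an R-row of half the
-- length (an odd cycle would make its start both a left and a right child), and by (i) the
-- missing L or R passes to the parents, so descent on the length gives a contradiction.
-- From such a root, coordinates are assigned along child edges, ChL and ChR contributing the
-- binary digits of k. Constraints (b)-(i) show that L-, R- and P-edges move coordinates exactly
-- as in the tree-like structure and that every level is full; (a) makes coordinates injective,
-- and connectivity gives every node coordinates.


open import Defs
open import Axiom.UniquenessOfIdentityProofs using (module Decidable⇒UIP)
open import Data.Bool using (true)
import Data.Bool.Properties as Bool
open import Data.Empty using (⊥; ⊥-elim)
open import Data.Fin using (Fin; toℕ; fromℕ)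
import Data.Fin.Properties as Fin
open import Data.List using ([]; _∷_; allFin)
open import Data.List.Extrema.Nat using (argmax; f[xs]≤f[argmax])
open import Data.List.Membership.Propositional.Properties using (∈-allFin)
import Data.List.Relation.Unary.All as All
open import Data.Nat using (ℕ; zero; suc; _+_; _*_; _∸_; _^_; _/_; _%_; _<_; _≤_; z≤n; s≤s; z<s; s<s)
open import Data.Nat.DivMod using (m*n/n≡m; m*n%n≡0; +-distrib-/)
open import Data.Nat.GeneralisedArithmetic using (iterate)
open import Data.Nat.Induction using (<-wellFounded)
open import Data.Nat.Properties
open import Data.Product using (∃; ∃₂; _×_; _,_; proj₁; proj₂)
open import Data.Product.Properties using (,-injective)
open import Data.Sum using (_⊎_; inj₁; inj₂; [_,_]′)
import Data.Sum as Sum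
open import Function.Base using (_∘_)
open import Function.Bundles using (_⇔_; mk⇔; Equivalence)
open import Induction.WellFounded using (Acc; acc)
open import Relation.Binary.Definitions using (DecidableEquality)
open import Relation.Binary.PropositionalEquality
open import Relation.Nullary using (Dec; yes; no; ¬_; contradiction)
open import Relation.Nullary.Decidable using (map′; _×-dec_; decidable-stable)
open import Relation.Unary using (Decidable)

label-code : Label → ℕ
label-code L   = 0
label-code R   = 1
label-code P   = 2
label-code ChL = 3
label-code ChR = 4

label-decode : ℕ → Label
label-decode 0 = L
label-decode 1 = R
label-decode 2 = P
label-decode 3 = ChL
label-decode _ = ChR

label-decode-code : ∀ a → label-decode (label-code a) ≡ a
label-decode-code L   = refl
label-decode-code R   = refl
label-decode-code P   = refl
label-decode-code ChL = refl
label-decode-code ChR = refl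

_≟ˡ_ : DecidableEquality Label
a ≟ˡ b = map′ code-injective (cong label-code) (label-code a ≟ label-code b)
  where
    code-injective : label-code a ≡ label-code b → a ≡ b
    code-injective eq =
      trans (sym (label-decode-code a)) (trans (cong label-decode eq) (label-decode-code b))

double/2 : ∀ k → 2 * k / 2 ≡ k
double/2 k = trans (cong (_/ 2) (*-comm 2 k)) (m*n/n≡m k 2)

suc-double/2 : ∀ k → suc (2 * k) / 2 ≡ k
suc-double/2 k = trans (+-distrib-/ 1 (2 * k) no-carry) (double/2 k)
  where
    no-carry : 1 % 2 + 2 * k % 2 < 2
    no-carry = subst (λ m → 1 + m < 2)
                 (sym (trans (cong (_% 2) (*-comm 2 k)) (m*n%n≡0 k 2))) ≤-refl

suc-double-< : ∀ {k m} → k < m → suc (2 * k) < 2 * m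
suc-double-< {k} {m} k<m = subst (_≤ 2 * m) (*-suc 2 k) (*-monoʳ-≤ 2 k<m)

half-< : ∀ {k m} → suc (suc (2 * k)) < 2 * m → suc k < m
half-< {k} {m} lt = *-cancelˡ-< 2 (suc k) m (subst (_< 2 * m) (sym (*-suc 2 k)) lt)

iterate-+ : ∀ {A : Set} (f : A → A) x a b → iterate f x (a + b) ≡ iterate f (iterate f x a) b
iterate-+ f x zero    b = refl
iterate-+ f x (suc a) b = iterate-+ f (f x) a b

first-failure : ∀ {P : ℕ → Set} → Decidable P → ∀ j →
                (∀ i → i < j → P i) ⊎ ∃ λ i → ¬ P i × (∀ i′ → i′ < i → P i′)
first-failure P? zero = inj₁ λ _ ()
first-failure P? (suc j) with first-failure P? j
... | inj₂ failure = inj₂ failure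
... | inj₁ below with P? j
...   | no ¬p = inj₂ (j , ¬p , below)
...   | yes p = inj₁ λ i i<1+j → [ below i , (λ { refl → p }) ]′ (m<1+n⇒m<n∨m≡n i<1+j)

module _ {n : ℕ} (G : LGraph n) (V : Valid G) where
  open LGraph G
  open Valid V

  infix 4 _—[_]→_
  _—[_]→_ : Fin n → Label → Fin n → Set
  u —[ l ]→ v = adj u v ≡ true × lab u v ≡ l

  Has? : ∀ u l → Dec (Has G u l)
  Has? u l = Fin.any? λ v → (adj u v Bool.≟ true) ×-dec (lab u v ≟ˡ l)

  edge-unique : ∀ {u v w l} → u —[ l ]→ v → u —[ l ]→ w → v ≡ w
  edge-unique {u} {v} {w} (a , e) (a′ , e′) =
    decidable-stable (v Fin.≟ w) λ v≢w → ca u v w a a′ v≢w (trans e (sym e′))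

  edge-irrelevant : ∀ {u v l} (e e′ : u —[ l ]→ v) → e ≡ e′
  edge-irrelevant (a , e) (a′ , e′) =
    cong₂ _,_ (Decidable⇒UIP.≡-irrelevant Bool._≟_ a a′) (Decidable⇒UIP.≡-irrelevant _≟ˡ_ e e′)

  edge-F : ∀ {u v l} → u —[ l ]→ v → F G u (l ∷ []) v
  edge-F {u} {v} {l} e = (e ∷ []) , λ { _ (e′ ∷ []) → only e′ }
    where
      only : ∀ {v′} (e′ : u —[ l ]→ v′) →
             _≡_ {A = ∃ (Walk G u (l ∷ []))} (v′ , e′ ∷ []) (v , e ∷ [])
      only e′ with edge-unique e′ e
      ... | refl = cong (λ e″ → v , e″ ∷ []) (edge-irrelevant e′ e)

  F-edge : ∀ {u v l} → F G u (l ∷ []) v → u —[ l ]→ v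
  F-edge ((e ∷ []) , _) = e

  L-reverse : ∀ {u v} → u —[ L ]→ v → v —[ R ]→ u
  L-reverse {u} {v} (a , e) = adj-sym u v a , cbL u v a e

  R-reverse : ∀ {u v} → u —[ R ]→ v → v —[ L ]→ u
  R-reverse {u} {v} (a , e) = adj-sym u v a , cbR u v a e

  ChL-reverse : ∀ {p x} → p —[ ChL ]→ x → x —[ P ]→ p
  ChL-reverse {p} {x} (a , e) = adj-sym p x a , cc-ChL p x a e

  ChR-reverse : ∀ {p x} → p —[ ChR ]→ x → x —[ P ]→ p
  ChR-reverse {p} {x} (a , e) = adj-sym p x a , cc-ChR p x a e

  P-reverse : ∀ {x p} → x —[ P ]→ p → p —[ ChL ]→ x ⊎ p —[ ChR ]→ x
  P-reverse {x} {p} (a , e) = Sum.map (adj-sym x p a ,_) (adj-sym x p a ,_) (ccP x p a e)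

  children-distinct : ∀ {p x} → p —[ ChL ]→ x → p —[ ChR ]→ x → ⊥
  children-distinct (_ , e) (_ , e′) with trans (sym e) e′
  ... | ()

  right-child-has-R : ∀ {p y} → p —[ ChR ]→ y → Has G y R ⇔ Has G p R
  right-child-has-R {p} {y} e@(_ , is-ChR) with ChR-reverse e
  ... | y→p@(a , is-P) with ciR y p a is-P is-ChR
  ... | _ , f , iff with edge-unique (F-edge f) y→p
  ... | refl = iff

  left-child-has-L : ∀ {p x} → p —[ ChL ]→ x → Has G x L ⇔ Has G p L
  left-child-has-L {p} {x} e@(_ , is-ChL) with ChL-reverse e
  ... | x→p@(a , is-P) with ciL x p a is-P is-ChL
  ... | _ , f , iff with edge-unique (F-edge f) x→p
  ... | refl = iff

  right-sibling : ∀ {p x} → p —[ ChL ]→ x → ∃ λ y → p —[ ChR ]→ y × x —[ R ]→ y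
  right-sibling {p} {x} e@(_ , is-ChL) with ChL-reverse e
  ... | x→p@(a , is-P) with cd x p a is-P is-ChL
  ... | (up ∷ down ∷ back ∷ []) , _ with edge-unique up x→p
  ... | refl = _ , down , L-reverse back

  left-sibling : ∀ {p y} → p —[ ChR ]→ y → ∃ λ x → p —[ ChL ]→ x × y —[ L ]→ x
  left-sibling {p} e with Equivalence.from (cf p) (_ , e)
  ... | x , e′ with right-sibling e′
  ... | _ , e″ , r with edge-unique e″ e
  ... | refl = x , e′ , R-reverse r

  R-of-left-child : ∀ {p x y} → p —[ ChL ]→ x → x —[ R ]→ y → p —[ ChR ]→ y
  R-of-left-child e r with right-sibling e
  ... | _ , e′ , r′ with edge-unique r′ r
  ... | refl = e′

  L-of-right-child : ∀ {p x y} → p —[ ChR ]→ y → y —[ L ]→ x → p —[ ChL ]→ x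
  L-of-right-child e f with left-sibling e
  ... | _ , e′ , f′ with edge-unique f′ f
  ... | refl = e′

  R-of-right-child : ∀ {p y z} → p —[ ChR ]→ y → y —[ R ]→ z → ∃ λ q → p —[ R ]→ q × q —[ ChL ]→ z
  R-of-right-child {p} {y} e@(_ , is-ChR) r with ChR-reverse e
  ... | y→p@(a , is-P) with ce y p a is-P is-ChR (_ , r)
  ... | (up ∷ across ∷ down ∷ back ∷ []) , _ with edge-unique up y→p | edge-unique (L-reverse back) r
  ... | refl | refl = _ , across , down

  L-of-left-child : ∀ {p x v} → p —[ ChL ]→ x → x —[ L ]→ v → ∃ λ q → p —[ L ]→ q × q —[ ChR ]→ v
  L-of-left-child {p} {x} e f with Equivalence.to (left-child-has-L e) (_ , f)
  ... | q , pq with Has? q ChR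
  ... | no q-no-ChR =
    -- by (h), a childless q would make its R-neighbour p childless
    ⊥-elim (proj₁ (chR q ((q-no-ChR ∘ Equivalence.to (cf q)) , q-no-ChR) p (edge-F (L-reverse pq))) (x , e))
  ... | yes (y , qy) with Equivalence.from (right-child-has-R qy) (_ , L-reverse pq)
  ... | _ , yz with R-of-right-child qy yz
  ... | _ , qq′ , q′z with edge-unique qq′ (L-reverse pq)
  ... | refl with edge-unique q′z e
  ... | refl with edge-unique (R-reverse yz) f
  ... | refl = q , pq , qy

  data Row (l : Label) : Fin n → ℕ → Fin n → Set where
    []  : ∀ {x} → Row l x 0 x
    _∷_ : ∀ {x y z j} → x —[ l ]→ y → Row l y j z → Row l x (suc j) z

  _∷ʳ_ : ∀ {l x y z j} → Row l x j y → y —[ l ]→ z → Row l x (suc j) z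
  [] ∷ʳ e = e ∷ []
  (e′ ∷ row) ∷ʳ e = e′ ∷ (row ∷ʳ e)

  reverse-L : ∀ {x y j} → Row L x j y → Row R y j x
  reverse-L [] = []
  reverse-L (e ∷ row) = reverse-L row ∷ʳ L-reverse e

  halve-row : ∀ {p x j y} → p —[ ChL ]→ x → Row R x j y →
              ∃₂ λ k q → Row R p k q × (j ≡ 2 * k × q —[ ChL ]→ y ⊎ j ≡ suc (2 * k) × q —[ ChR ]→ y)
  halve-row e [] = 0 , _ , [] , inj₁ (refl , e)
  halve-row e (r ∷ []) = 0 , _ , [] , inj₂ (refl , R-of-left-child e r)
  halve-row e (r ∷ r′ ∷ row) with R-of-right-child (R-of-left-child e r) r′
  ... | _ , pq , e′ with halve-row e′ row
  ... | k , _ , row′ , inj₁ (refl , e″) = suc k , _ , pq ∷ row′ , inj₁ (sym (*-suc 2 k) , e″)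
  ... | k , _ , row′ , inj₂ (refl , e″) = suc k , _ , pq ∷ row′ , inj₂ (cong suc (sym (*-suc 2 k)) , e″)

  module _ (l : Label) where
    next : Fin n → Fin n
    next x with Has? x l
    ... | yes (y , _) = y
    ... | no _ = x

    next-edge : ∀ {x} → Has G x l → x —[ l ]→ next x
    next-edge {x} h with Has? x l
    ... | yes (_ , e) = e
    ... | no ¬h = contradiction h ¬h

    orbit-row : ∀ x j → (∀ i → i < j → Has G (iterate next x i) l) → Row l x j (iterate next x j)
    orbit-row x zero    _   = []
    orbit-row x (suc j) has = next-edge (has 0 z<s) ∷ orbit-row (next x) j λ i i<j → has (suc i) (s<s i<j)

    follow : ∀ s → (∃₂ λ j t → Row l s j t × ¬ Has G t l) ⊎ (∃₂ λ m y → Row l y (suc m) y)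
    follow s with first-failure (λ i → Has? (iterate next s i) l) (suc n)
    ... | inj₂ (i , stuck , below) = inj₁ (i , _ , orbit-row s i below , stuck)
    ... | inj₁ all with Fin.pigeonhole (n<1+n n) (λ i → iterate next s (toℕ i))
    ... | a , b , a<b , same = inj₂ (m , _ , subst (Row l y (suc m)) closes (orbit-row y (suc m) has))
      where
        y = iterate next s (toℕ a)
        m = toℕ b ∸ suc (toℕ a)
        a+1+m≡b : toℕ a + suc m ≡ toℕ b
        a+1+m≡b = trans (+-suc (toℕ a) m) (m+[n∸m]≡n a<b)
        has : ∀ i → i < suc m → Has G (iterate next y i) l
        has i i<1+m = subst (λ x → Has G x l) (iterate-+ next s (toℕ a) i)
          (all (toℕ a + i) (<-trans (subst (_ <_) a+1+m≡b (+-monoʳ-< (toℕ a) i<1+m)) (Fin.toℕ<n b)))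
        closes : iterate next y (suc m) ≡ y
        closes = trans (sym (iterate-+ next s (toℕ a) (suc m))) (trans (cong (iterate next s) a+1+m≡b) (sym same))

  module Rootless (has-parent : ∀ x → Has G x P) where
    parent-edge : ∀ x → ∃ λ p → p —[ ChL ]→ x ⊎ p —[ ChR ]→ x
    parent-edge x = let (p , e) = has-parent x in p , P-reverse e

    no-R-cycle : ∀ {m x} → Acc _<_ (suc m) → Row R x (suc m) x → ⊥
    no-left-R-cycle : ∀ {m p x} → Acc _<_ (suc m) → p —[ ChL ]→ x → Row R x (suc m) x → ⊥

    no-R-cycle wf row@(r ∷ rest) with parent-edge _
    ... | _ , inj₁ e = no-left-R-cycle wf e row
    ... | _ , inj₂ e = no-left-R-cycle wf (proj₂ (proj₂ (R-of-right-child e r))) (rest ∷ʳ r)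

    no-left-R-cycle (acc smaller) e row with halve-row e row
    ... | zero  , _ , _    , inj₁ (() , _)
    ... | suc k , _ , row′ , inj₁ (eq , e′) with edge-unique (ChL-reverse e′) (ChL-reverse e)
    ...   | refl = no-R-cycle (smaller (subst (suc k <_) (sym eq) (m<m+n (suc k) z<s))) row′
    no-left-R-cycle _ e row | _ , _ , _ , inj₂ (_ , e′) with edge-unique (ChL-reverse e) (ChR-reverse e′)
    ...   | refl = children-distinct e e′

    no-R-segment : ∀ {j s t} → Acc _<_ j → Row R s j t → ¬ Has G s L → ¬ Has G t R → ⊥
    no-R-segment {s = s} (acc smaller) row no-L no-R with parent-edge s
    ... | _ , inj₂ e = no-L (let (x , _ , f) = left-sibling e in x , f)
    ... | _ , inj₁ e with halve-row e row
    ...   | _ , _ , _ , inj₁ (_ , e′) = no-R (let (y , _ , r) = right-sibling e′ in y , r)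
    ...   | k , _ , row′ , inj₂ (refl , e′) =
      no-R-segment (smaller (s≤s (m≤m+n k (k + 0)))) row′
        (no-L ∘ Equivalence.from (left-child-has-L e)) (no-R ∘ Equivalence.from (right-child-has-R e′))

    rootless-impossible : Fin n → ⊥
    rootless-impossible x with follow L x
    ... | inj₂ (_ , _ , cycle) = no-R-cycle (<-wellFounded _) (reverse-L cycle)
    ... | inj₁ (_ , s , _ , no-L) with follow R s
    ...   | inj₁ (_ , _ , row , no-R) = no-R-segment (<-wellFounded _) row no-L no-R
    ...   | inj₂ (_ , _ , cycle) = no-R-cycle (<-wellFounded _) cycle

  root-exists : Fin n → ∃ λ r → ¬ Has G r P
  root-exists x = Fin.¬∀⟶∃¬ n (λ u → Has G u P) (λ u → Has? u P)
                    λ has-parent → Rootless.rootless-impossible has-parent x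

  module Rooted (r : Fin n) (r-root : ¬ Has G r P) where
    r-no-L : ¬ Has G r L
    r-no-L = proj₁ (Equivalence.to (cg r) r-root)

    r-no-R : ¬ Has G r R
    r-no-R = proj₂ (Equivalence.to (cg r) r-root)

    data At : Fin n → ℕ → ℕ → Set where
      root   : At r 0 0
      viaChL : ∀ {p x l k} → At p l k → p —[ ChL ]→ x → At x (suc l) (2 * k)
      viaChR : ∀ {p x l k} → At p l k → p —[ ChR ]→ x → At x (suc l) (suc (2 * k))

    At-unique : ∀ {u v l l′ k k′} → At u l k → At v l′ k′ → l ≡ l′ → k ≡ k′ → u ≡ v
    At-unique root root _ _ = refl
    At-unique root (viaChL _ _) () _
    At-unique root (viaChR _ _) () _
    At-unique (viaChL _ _) root () _
    At-unique (viaChR _ _) root () _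
    At-unique (viaChL a e) (viaChL b f) l≡l′ k≡k′
      with At-unique a b (suc-injective l≡l′) (*-cancelˡ-≡ _ _ 2 k≡k′)
    ... | refl = edge-unique e f
    At-unique (viaChR a e) (viaChR b f) l≡l′ k≡k′
      with At-unique a b (suc-injective l≡l′) (*-cancelˡ-≡ _ _ 2 (suc-injective k≡k′))
    ... | refl = edge-unique e f
    At-unique (viaChL {k = k} _ _) (viaChR {k = k′} _ _) _ eq = contradiction eq (even≢odd k k′)
    At-unique (viaChR {k = k} _ _) (viaChL {k = k′} _ _) _ eq = contradiction (sym eq) (even≢odd k′ k)

    At-injective : ∀ {u l l′ k k′} → At u l k → At u l′ k′ → (l , k) ≡ (l′ , k′)
    At-injective root root = refl
    At-injective root (viaChL _ e) = ⊥-elim (r-root (_ , ChL-reverse e))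
    At-injective root (viaChR _ e) = ⊥-elim (r-root (_ , ChR-reverse e))
    At-injective (viaChL _ e) root = ⊥-elim (r-root (_ , ChL-reverse e))
    At-injective (viaChR _ e) root = ⊥-elim (r-root (_ , ChR-reverse e))
    At-injective (viaChL a e) (viaChL b f) with edge-unique (ChL-reverse e) (ChL-reverse f)
    ... | refl with At-injective a b
    ... | refl = refl
    At-injective (viaChR a e) (viaChR b f) with edge-unique (ChR-reverse e) (ChR-reverse f)
    ... | refl with At-injective a b
    ... | refl = refl
    At-injective (viaChL _ e) (viaChR _ f) with edge-unique (ChL-reverse e) (ChR-reverse f)
    ... | refl = ⊥-elim (children-distinct e f)
    At-injective (viaChR _ e) (viaChL _ f) with edge-unique (ChR-reverse e) (ChL-reverse f)
    ... | refl = ⊥-elim (children-distinct f e)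

    At-bound : ∀ {u l k} → At u l k → k < 2 ^ l
    At-bound root = z<s
    At-bound (viaChL a _) = <-trans (n<1+n _) (suc-double-< (At-bound a))
    At-bound (viaChR a _) = suc-double-< (At-bound a)

    At-up : ∀ {x l k} → At x (suc l) k → ∃ λ p → At p l (k / 2) × x —[ P ]→ p
    At-up (viaChL {k = k} a e) = _ , subst (At _ _) (sym (double/2 k)) a , ChL-reverse e
    At-up (viaChR {k = k} a e) = _ , subst (At _ _) (sym (suc-double/2 k)) a , ChR-reverse e

    At-parent : ∀ {x v l k} → At x (suc l) k → x —[ P ]→ v → At v l (k / 2)
    At-parent a e with At-up a
    ... | _ , b , e′ with edge-unique e′ e
    ... | refl = b

    At-P : ∀ {x v l k} → At x l k → x —[ P ]→ v → ∃ λ l′ → l ≡ suc l′ × At v l′ (k / 2)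
    At-P root e = ⊥-elim (r-root (_ , e))
    At-P a@(viaChL _ _) e = _ , refl , At-parent a e
    At-P a@(viaChR _ _) e = _ , refl , At-parent a e

    At-R : ∀ {w v l k} → At w l k → w —[ R ]→ v → At v l (suc k)
    At-R root r = ⊥-elim (r-no-R (_ , r))
    At-R (viaChL a e) r = viaChR a (R-of-left-child e r)
    At-R (viaChR {k = k} a e) r with R-of-right-child e r
    ... | _ , pq , e′ = subst (At _ _) (*-suc 2 k) (viaChL (At-R a pq) e′)

    At-L : ∀ {w v l k} → At w l k → w —[ L ]→ v → ∃ λ k′ → k ≡ suc k′ × At v l k′
    At-L root f = ⊥-elim (r-no-L (_ , f))
    At-L (viaChR a e) f = _ , refl , viaChL a (L-of-right-child e f)
    At-L (viaChL a e) f with L-of-left-child e f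
    ... | _ , pq , e′ with At-L a pq
    ... | k′ , refl , b = _ , *-suc 2 k′ , viaChR b e′

    At-has-R : ∀ {u l k} → At u l k → suc k < 2 ^ l → Has G u R
    At-has-R root (s≤s ())
    At-has-R (viaChL _ e) _ = let (y , _ , r) = right-sibling e in y , r
    At-has-R (viaChR a e) bound = Equivalence.from (right-child-has-R e) (At-has-R a (half-< bound))

    At-has-L : ∀ {u l k} → At u l k → 0 < k → Has G u L
    At-has-L root ()
    At-has-L (viaChL {k = zero} _ _) ()
    At-has-L (viaChL {k = suc _} a e) _ = Equivalence.from (left-child-has-L e) (At-has-L a z<s)
    At-has-L (viaChR _ e) _ = let (x , _ , f) = left-sibling e in x , f

    leftmost : ∀ {u l} k → At u l k → ∃ λ v → At v l 0
    leftmost zero a = _ , a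
    leftmost (suc k) a with At-has-L a z<s
    ... | _ , f with At-L a f
    ... | _ , refl , b = leftmost k b

    row-complete : ∀ {u l k} → At u l k → ∀ k′ → k′ < 2 ^ l → ∃ λ v → At v l k′
    row-complete a zero _ = leftmost _ a
    row-complete a (suc k′) k′<2^l with row-complete a k′ (<-trans (n<1+n k′) k′<2^l)
    ... | _ , b with At-has-R b k′<2^l
    ... | _ , r = _ , At-R b r

    ancestor-at-level : ∀ {u l l′ k} → At u l′ k → l ≤ l′ → ∃₂ λ v k′ → At v l k′
    ancestor-at-level {l′ = zero} a z≤n = _ , _ , a
    ancestor-at-level {l′ = suc _} a l≤1+l′ with m≤n⇒m<n∨m≡n l≤1+l′
    ... | inj₂ refl = _ , _ , a
    ... | inj₁ l<1+l′ = ancestor-at-level (proj₁ (proj₂ (At-up a))) (≤-pred l<1+l′)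

    Adjacent : ℕ × ℕ → ℕ × ℕ → Set
    Adjacent c c′ = TEdge c c′ ⊎ TEdge c′ c

    At-neighbour : ∀ {u v l k} → At u l k → adj u v ≡ true →
                   ∃₂ λ l′ k′ → At v l′ k′ × Adjacent (l , k) (l′ , k′)
    At-neighbour {u} {v} a uv with lab u v in eq
    ... | L   = let (_ , k≡ , b) = At-L a (uv , eq) in _ , _ , b , inj₁ (inj₂ (refl , k≡))
    ... | R   = _ , _ , At-R a (uv , eq) , inj₂ (inj₂ (refl , refl))
    ... | P   = let (_ , l≡ , b) = At-P a (uv , eq) in _ , _ , b , inj₁ (inj₁ (l≡ , refl))
    ... | ChL = _ , _ , viaChL a (uv , eq) , inj₂ (inj₁ (refl , sym (double/2 _)))
    ... | ChR = _ , _ , viaChR a (uv , eq) , inj₂ (inj₁ (refl , sym (suc-double/2 _)))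

    TEdge-adjacent : ∀ {u v l l′ k k′} → At u l k → At v l′ k′ → TEdge (l , k) (l′ , k′) → adj u v ≡ true
    TEdge-adjacent a b (inj₁ (refl , refl)) with At-up a
    ... | _ , a′ , e with At-unique a′ b refl refl
    ... | refl = proj₁ e
    TEdge-adjacent a b (inj₂ (refl , refl)) with At-has-R b (At-bound a)
    ... | _ , r with At-unique (At-R b r) a refl refl
    ... | refl = adj-sym _ _ (proj₁ r)

    At-reachable : ∀ {u v l k} → At u l k → Reach G u v → ∃₂ λ l′ k′ → At v l′ k′
    At-reachable a here = _ , _ , a
    At-reachable a (step uw rest) = let (_ , _ , b , _) = At-neighbour a uw in At-reachable b rest

    module _ (connected : Connected G) where
      coordinates : ∀ u → ∃₂ λ l k → At u l k
      coordinates u = At-reachable root (connected r u)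

      coord : Fin n → ℕ × ℕ
      coord u = proj₁ (coordinates u) , proj₁ (proj₂ (coordinates u))

      level : Fin n → ℕ
      level = proj₁ ∘ coord

      at : ∀ u → At u (level u) (proj₂ (coord u))
      at u = proj₂ (proj₂ (coordinates u))

      deepest : Fin n
      deepest = argmax level r (allFin n)

      level≤deepest : ∀ u → level u ≤ level deepest
      level≤deepest u = All.lookup (f[xs]≤f[argmax] r (allFin n)) (∈-allFin u)

      tree-like : TreeLike G (suc (level deepest))
      tree-like = coord
                , (λ u → s≤s (level≤deepest u) , At-bound (at u))
                , (λ u v eq → let (l≡ , k≡) = ,-injective eq in At-unique (at u) (at v) l≡ k≡)
                , surjective
                , λ u v → mk⇔ (adjacent⇒ u v) [ TEdge-adjacent (at u) (at v) , adj-sym v u ∘ TEdge-adjacent (at v) (at u) ]′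
        where
          surjective : ∀ l k → l < suc (level deepest) → k < 2 ^ l → ∃ λ u → coord u ≡ (l , k)
          surjective l k l<ℓ k<2^l =
            let (_ , _ , b) = ancestor-at-level (at deepest) (≤-pred l<ℓ)
                (w , c) = row-complete b k k<2^l
            in w , At-injective (at w) c

          adjacent⇒ : ∀ u v → adj u v ≡ true → Adjacent (coord u) (coord v)
          adjacent⇒ u v uv =
            let (_ , _ , b , adjacent) = At-neighbour (at u) uv
            in subst (Adjacent (coord u)) (At-injective b (at v)) adjacent

lemma6p6 : ∀ (n : ℕ) (G : LGraph n) → Connected G → Valid G → IsTreeLike G
lemma6p6 zero    G _         _ = 0 , (λ ()) , (λ ()) , (λ ()) , (λ _ _ ()) , (λ ())
lemma6p6 (suc n) G connected V =
  let (r , r-root) = root-exists G V (fromℕ n)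
  in _ , Rooted.tree-like G V r r-root connected
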